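{- Let $\mu$ be a distribution over subsets of $[n]$ of size $q$ whose support has size at most $\eta n$, and let $\mathcal M_i,\mathcal C_i,\mathcal S_i$ ($0\le i\le q$) be as defined below. If $\mu(\mathcal S_0)\le\frac1{q+1}$, then for some $i\in[q]$ the pair $(\mathcal C_i,\mathcal S_i)$ (core set $\mathcal C_i$, family $\mathcal S_i$) is an $(\eta q,i)$-constellation for $\mu$.
   Context: Definition: $\mathcal M_0=\mathrm{supp}(\mu)$, and $\mathcal C_0$ is the set of $j\in[n]$ belonging to at least $n^{1/q}$ sets of $\mathcal M_0$. For $i=0,\dots,q$, once $\mathcal M_i,\mathcal C_i$ are defined, $\mathcal S_i$ is the set of $Q\in\mathcal M_i$ with $|Q\cap\mathcal C_i|=q-i$. For $i=1,\dots,q$, $\mathcal M_i=\mathcal M_{i-1}\setminus\mathcal S_{i-1}$, and $\mathcal C_i$ is the set of $j\in[n]$ belonging to at least $n^{i/q}$ sets of $\mathcal M_i$. For a family $\mathcal A$ of sets, $\mu(\mathcal A)=\sum_{Q\in\mathcal A}\mu(Q)$. For $i\in[q]$ and $\eta'>0$, an $(\eta',i)$-constellation for $\mu$ is a pair $(C,\mathcal S)$ with $C\subseteq[n]$ and $\mathcal S\subseteq\mathrm{supp}(\mu)$ such that: (1) $|C|<\eta'n^{1-i/q}$; (2) $\mu(\mathcal S)\ge\frac1{q+1}$; (3) $|Q\cap C|=q-i$ for every $Q\in\mathcal S$; (4) if $i>1$, every $j\in\bigcup_{Q\in\mathcal S}Q\setminus C$ belongs to at most $n^{(i-1)/q}$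 sets of $\mathcal S$.
   Formalization: The probabilities assigned by the distribution μ and the parameter η are rational numbers. -}

module Defs where

open import Data.Bool using (Bool; true; false; _∧_; not; if_then_else_)
open import Data.Nat as ℕ using (ℕ; zero; suc; _∸_; _≡ᵇ_)
open import Data.Nat.Properties as ℕP using ()
open import Data.Integer using (+_)
open import Data.Rational as ℚ using (ℚ; 0ℚ; 1ℚ; _/_)
open import Data.Rational.Properties as ℚP using ()
open import Data.Fin using (Fin)
open import Data.Fin.Subset using (Subset; _∩_; ∣_∣; _∈_; inside; outside)
open import Data.Vec using (Vec; []; _∷_; tabulate; lookup)
open import Data.List using (List; []; _∷_; _++_; map; foldr; length; filter)
open import Data.Product using (Σ; _×_; _,_)
open import Relation.Nullary using (does)
open import Relation.Binary.PropositionalEquality using (_≡_)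

allSubsets : ∀ n → List (Subset n)
allSubsets zero = [] ∷ []
allSubsets (suc n) = map (inside ∷_) (allSubsets n) ++ map (outside ∷_) (allSubsets n)

Weights : ℕ → Set
Weights n = Subset n → ℚ

Family : ℕ → Set
Family n = Subset n → Bool

sumAll : ∀ {n} → (Subset n → ℚ) → ℚ
sumAll {n} f = foldr (λ Q acc → f Q ℚ.+ acc) 0ℚ (allSubsets n)

countAll : ∀ {n} → (Subset n → Bool) → ℕ
countAll {n} p = foldr (λ Q acc → if p Q then suc acc else acc) 0 (allSubsets n)

measure : ∀ {n} → Weights n → Family n → ℚ
measure μ 𝒜 = sumAll (λ Q → if 𝒜 Q then μ Q else 0ℚ)

supp : ∀ {n} → Weights n → Family n
supp μ Q = does (0ℚ ℚP.<? μ Q)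

deg : ∀ {n} → Family n → Fin n → ℕ
deg 𝒜 j = countAll (λ Q → 𝒜 Q ∧ lookup Q j)

IsDistribution : (n q : ℕ) → Weights n → Set
IsDistribution n q μ =
  (∀ Q → 0ℚ ℚ.≤ μ Q) ×
  (∀ Q → supp μ Q ≡ true → ∣ Q ∣ ≡ q) ×
  (sumAll μ ≡ 1ℚ)

_^ℚ_ : ℚ → ℕ → ℚ
x ^ℚ zero = 1ℚ
x ^ℚ suc k = x ℚ.* (x ^ℚ k)

toℚ : ℕ → ℚ
toℚ m = + m / 1

-- "j belongs to at least n^{e/q} sets of 𝒜", i.e. deg ≥ n^{e/q}, which for
-- natural numbers (q ≥ 1) is equivalent to deg^q ≥ n^e.
coreOf : (n q i : ℕ) → Family n → Subset n
coreOf n q e 𝒜 = tabulate (λ j → does ((n ℕ.^ e) ℕP.≤? (deg 𝒜 j ℕ.^ q)))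

stratumOf : ∀ {n} → (q i : ℕ) → Family n → Subset n → Family n
stratumOf q i 𝓜 C Q = 𝓜 Q ∧ (∣ Q ∩ C ∣ ≡ᵇ (q ∸ i))

-- Exponent of the threshold defining 𝒞_i: n^{1/q} for i = 0 (as in the
-- paper's definition of 𝒞_0), and n^{i/q} for i ≥ 1.
coreExp : ℕ → ℕ
coreExp zero = 1
coreExp (suc k) = suc k

𝓜 : (n q : ℕ) → Weights n → ℕ → Family n
𝒞 : (n q : ℕ) → Weights n → ℕ → Subset n
𝒮 : (n q : ℕ) → Weights n → ℕ → Family n
𝓜 n q μ zero = supp μ
𝓜 n q μ (suc i) Q = 𝓜 n q μ i Q ∧ not (𝒮 n q μ i Q)
𝒞 n q μ i = coreOf n q (coreExp i) (𝓜 n q μ i)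
𝒮 n q μ i = stratumOf q i (𝓜 n q μ i) (𝒞 n q μ i)

-- |C| < η' · n^{1 - i/q}; as both sides are ≥ 0 (the right side requires η' > 0
-- to exceed |C| ≥ 0), this is equivalent to η' > 0 ∧ |C|^q < η'^q · n^{q-i}.
SmallCore : (n q i : ℕ) → ℚ → Subset n → Set
SmallCore n q i η' C =
  (0ℚ ℚ.< η') × ((toℚ ∣ C ∣ ^ℚ q) ℚ.< ((η' ^ℚ q) ℚ.* toℚ (n ℕ.^ (q ∸ i))))

IsConstellation : (n q : ℕ) → Weights n → ℚ → ℕ → Subset n → Family n → Set
IsConstellation n q μ η' i C 𝒮′ =
  (∀ Q → 𝒮′ Q ≡ true → supp μ Q ≡ true) ×
  SmallCore n q i η' C ×
  ((+ 1 / suc q) ℚ.≤ measure μ 𝒮′) ×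
  (∀ Q → 𝒮′ Q ≡ true → ∣ Q ∩ C ∣ ≡ q ∸ i) ×
  -- (4) if i > 1, each j ∈ ⋃𝒮 \ C lies in at most n^{(i-1)/q} sets of 𝒮
  --     (deg ≤ n^{(i-1)/q} ⇔ deg^q ≤ n^{i-1})
  (1 ℕ.< i → ∀ (j : Fin n) → (Σ (Subset n) λ Q → 𝒮′ Q ≡ true × j ∈ Q) →
     lookup C j ≡ false → (deg 𝒮′ j ℕ.^ q) ℕ.≤ (n ℕ.^ (i ∸ 1)))

suppSize : ∀ {n} → Weights n → ℕ
suppSize μ = countAll (supp μ)

-- Every Q ∈ 𝓜ᵢ meets 𝒞ᵢ in at most q − i points: the cores shrink as i grows, and
-- Q ∉ 𝒮ᵢ₋₁ makes the previous bound strict. Hence 𝓜_{q+1} = ∅, the strata 𝒮₀, …, 𝒮_q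
-- partition supp μ, and as μ(𝒮₀) ≤ 1/(q+1) some 𝒮ᵢ with i ≥ 1 has μ(𝒮ᵢ) ≥ 1/(q+1).
-- The core is small by double counting the pairs (j, Q) with j ∈ Q ∩ 𝒞ᵢ and Q ∈ 𝓜ᵢ:
-- each j ∈ 𝒞ᵢ lies in at least n^{i/q} such Q and each Q meets 𝒞ᵢ in at most q − 1
-- points, so |𝒞ᵢ| n^{i/q} ≤ (q − 1)|supp μ| < ηqn. A point of Q ∈ 𝒮ᵢ outside 𝒞ᵢ is also
-- outside 𝒞ᵢ₋₁ (else Q would lie in 𝒮ᵢ₋₁), so it lies in fewer than n^{(i−1)/q} sets
-- of 𝓜ᵢ₋₁ ⊇ 𝒮ᵢ.

module Submission where

open import Defs
open import Data.Nat using (ℕ; suc; _≤_)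
open import Data.Integer using (+_)
open import Data.Rational using (ℚ; _/_) renaming (_≤_ to _≤ℚ_; _*_ to _*ℚ_)
open import Data.Product using (Σ; _×_)

open import Data.Nat using (zero; _+_; _*_; _∸_; _^_; _<_; _≡ᵇ_; z≤n; s≤s; pred)
import Data.Nat.Properties as ℕP
open import Data.Nat.Coprimality using (1-coprimeTo) renaming (sym to coprime-sym)
import Data.Integer as ℤ
import Data.Integer.Properties as ℤP
open import Data.Rational using (0ℚ; 1ℚ; mkℚ; *≤*; *<*; -_; nonNegative; positive)
  renaming (_+_ to _+ℚ_; _<_ to _<ℚ_)
import Data.Rational.Properties as ℚP
open import Data.Rational.Solver using (module +-*-Solver)
open import Data.Nat.Solver using () renaming (module +-*-Solver to ℕSolver)
open import Data.Bool using (Bool; true; false; _∧_; not; if_then_else_)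
open import Data.Bool.Properties using (∧-conicalˡ; ∧-conicalʳ; T-≡; not-injective; not-¬)
open import Data.Empty using (⊥-elim)
open import Data.Fin using (Fin; zero; suc)
open import Data.Fin.Subset using (Subset; _∩_; ∣_∣; _∈_; _∉_; _⊆_; Nonempty)
open import Data.Fin.Subset.Properties
  using (nonempty?; Empty-unique; ∣⊥∣≡0; x∈p∩q⁺; x∈p∩q⁻; p⊆q⇒∣p∣≤∣q∣; p⊂q⇒∣p∣<∣q∣; ∣p∩q∣≤∣p∣)
open import Data.List using (List; []; _∷_; foldr)
open import Data.Product using (_,_; proj₁; proj₂)
open import Data.Vec using ([]; _∷_; lookup; here; there)
open import Data.Vec.Properties using (lookup∘tabulate; lookup-zipWith; []=⇒lookup; lookup⇒[]=)
open import Function using (_∘_; id; Equivalence)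
open import Relation.Nullary using (Dec; yes; no)
open import Relation.Nullary.Decidable using (dec-true)
open import Relation.Binary.PropositionalEquality
  using (_≡_; refl; sym; trans; cong; cong₂; subst; subst₂; module ≡-Reasoning)
open import Algebra.Properties.Semiring.Sum ℕP.+-*-semiring
  using (sum; sum-cong-≗; sum-replicate-zero; ∑-distrib-+; *-distribˡ-sum)

toℚ≡mkℚ : ∀ m → toℚ m ≡ mkℚ (+ m) 0 (coprime-sym (1-coprimeTo m))
toℚ≡mkℚ m = ℚP.normalize-coprime (coprime-sym (1-coprimeTo m))

toℚ-+ : ∀ a b → toℚ (a + b) ≡ toℚ a +ℚ toℚ b
toℚ-+ a b rewrite toℚ≡mkℚ a | toℚ≡mkℚ b =
  cong (λ z → z / 1) (sym (cong₂ ℤ._+_ (ℤP.*-identityʳ (+ a)) (ℤP.*-identityʳ (+ b))))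

toℚ-* : ∀ a b → toℚ (a * b) ≡ toℚ a *ℚ toℚ b
toℚ-* a b rewrite toℚ≡mkℚ a | toℚ≡mkℚ b = cong (λ z → z / 1) (ℤP.pos-* a b)

toℚ-^ : ∀ a k → toℚ (a ^ k) ≡ toℚ a ^ℚ k
toℚ-^ a zero    = refl
toℚ-^ a (suc k) = trans (toℚ-* a (a ^ k)) (cong (toℚ a *ℚ_) (toℚ-^ a k))

toℚ-mono-≤ : ∀ {a b} → a ≤ b → toℚ a ≤ℚ toℚ b
toℚ-mono-≤ {a} {b} a≤b rewrite toℚ≡mkℚ a | toℚ≡mkℚ b =
  *≤* (subst₂ ℤ._≤_ (sym (ℤP.*-identityʳ (+ a))) (sym (ℤP.*-identityʳ (+ b))) (ℤ.+≤+ a≤b))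

toℚ-mono-< : ∀ {a b} → a < b → toℚ a <ℚ toℚ b
toℚ-mono-< {a} {b} a<b rewrite toℚ≡mkℚ a | toℚ≡mkℚ b =
  *<* (subst₂ ℤ._<_ (sym (ℤP.*-identityʳ (+ a))) (sym (ℤP.*-identityʳ (+ b))) (ℤ.+<+ a<b))

toℚ-nonNeg : ∀ a → 0ℚ ≤ℚ toℚ a
toℚ-nonNeg a = toℚ-mono-≤ {0} {a} z≤n

toℚ[1+m]*1/[1+m]≡1 : ∀ m → toℚ (suc m) *ℚ (+ 1 / suc m) ≡ 1ℚ
toℚ[1+m]*1/[1+m]≡1 m rewrite toℚ≡mkℚ (suc m) | ℚP.normalize-coprime {1} {m} (1-coprimeTo (suc m)) =
  ℚP.*-inverseʳ (mkℚ (+ suc m) 0 (coprime-sym (1-coprimeTo (suc m))))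

*-nonNeg : ∀ {a b} → 0ℚ ≤ℚ a → 0ℚ ≤ℚ b → 0ℚ ≤ℚ a *ℚ b
*-nonNeg {a} {b} 0≤a 0≤b =
  ℚP.nonNegative⁻¹ _ {{ℚP.nonNeg*nonNeg⇒nonNeg a {{nonNegative 0≤a}} b {{nonNegative 0≤b}}}}

*-pos : ∀ {a b} → 0ℚ <ℚ a → 0ℚ <ℚ b → 0ℚ <ℚ a *ℚ b
*-pos {a} {b} 0<a 0<b =
  ℚP.positive⁻¹ _ {{ℚP.pos*pos⇒pos a {{positive 0<a}} b {{positive 0<b}}}}

^ℚ-nonNeg : ∀ k {a} → 0ℚ ≤ℚ a → 0ℚ ≤ℚ a ^ℚ k
^ℚ-nonNeg zero    _   = ℚP.nonNegative⁻¹ 1ℚ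
^ℚ-nonNeg (suc k) 0≤a = *-nonNeg 0≤a (^ℚ-nonNeg k 0≤a)

^ℚ-pos : ∀ k {a} → 0ℚ <ℚ a → 0ℚ <ℚ a ^ℚ k
^ℚ-pos zero    _   = ℚP.positive⁻¹ 1ℚ
^ℚ-pos (suc k) 0<a = *-pos 0<a (^ℚ-pos k 0<a)

^ℚ-monoˡ-≤ : ∀ k {a b} → 0ℚ ≤ℚ a → a ≤ℚ b → a ^ℚ k ≤ℚ b ^ℚ k
^ℚ-monoˡ-≤ zero    _   _   = ℚP.≤-refl
^ℚ-monoˡ-≤ (suc k) {a} {b} 0≤a a≤b = ℚP.≤-trans
  (ℚP.*-monoʳ-≤-nonNeg (a ^ℚ k) {{nonNegative (^ℚ-nonNeg k 0≤a)}} a≤b)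
  (ℚP.*-monoˡ-≤-nonNeg b {{nonNegative (ℚP.≤-trans 0≤a a≤b)}} (^ℚ-monoˡ-≤ k 0≤a a≤b))

^ℚ-monoˡ-< : ∀ k {a b} → 0ℚ ≤ℚ a → a <ℚ b → a ^ℚ suc k <ℚ b ^ℚ suc k
^ℚ-monoˡ-< k {a} {b} 0≤a a<b = ℚP.≤-<-trans
  (ℚP.*-monoˡ-≤-nonNeg a {{nonNegative 0≤a}} (^ℚ-monoˡ-≤ k 0≤a (ℚP.<⇒≤ a<b)))
  (ℚP.*-monoˡ-<-pos (b ^ℚ k) {{positive (^ℚ-pos k (ℚP.≤-<-trans 0≤a a<b))}} a<b)

^ℚ-distrib-* : ∀ a b k → (a *ℚ b) ^ℚ k ≡ a ^ℚ k *ℚ b ^ℚ k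
^ℚ-distrib-* a b zero    = refl
^ℚ-distrib-* a b (suc k) rewrite ^ℚ-distrib-* a b k =
  solve 4 (λ a b x y → (a :* b) :* (x :* y) := (a :* x) :* (b :* y)) refl a b (a ^ℚ k) (b ^ℚ k)
  where open +-*-Solver

+-cancelʳ-≤ : ∀ c {a b} → a +ℚ c ≤ℚ b +ℚ c → a ≤ℚ b
+-cancelʳ-≤ c {a} {b} a+c≤b+c =
  subst₂ _≤ℚ_ (a+c-c≡a a c) (a+c-c≡a b c) (ℚP.+-monoˡ-≤ (- c) a+c≤b+c)
  where
  a+c-c≡a : ∀ a c → a +ℚ c +ℚ - c ≡ a
  a+c-c≡a = solve 2 (λ a c → a :+ c :- c := a) refl
    where open +-*-Solver

-- Pigeonhole

sumBelow : ℕ → (ℕ → ℚ) → ℚ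
sumBelow zero    a = 0ℚ
sumBelow (suc k) a = sumBelow k a +ℚ a k

pigeonhole-step : ∀ (a : ℕ → ℚ) (c : ℚ) k →
  a 0 +ℚ toℚ (2 + k) *ℚ c ≤ℚ sumBelow (3 + k) a → a (2 + k) ≤ℚ c →
  a 0 +ℚ toℚ (suc k) *ℚ c ≤ℚ sumBelow (2 + k) a
pigeonhole-step a c k h a≤c = +-cancelʳ-≤ c (begin
  a 0 +ℚ toℚ (suc k) *ℚ c +ℚ c     ≡⟨ regroup (a 0) (toℚ (suc k)) c ⟩
  a 0 +ℚ (1ℚ +ℚ toℚ (suc k)) *ℚ c  ≡⟨ cong (λ t → a 0 +ℚ t *ℚ c) (sym (toℚ-+ 1 (suc k))) ⟩
  a 0 +ℚ toℚ (2 + k) *ℚ c          ≤⟨ h ⟩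
  sumBelow (2 + k) a +ℚ a (2 + k)  ≤⟨ ℚP.+-monoʳ-≤ (sumBelow (2 + k) a) a≤c ⟩
  sumBelow (2 + k) a +ℚ c          ∎)
  where
  open ℚP.≤-Reasoning
  regroup : ∀ x t c → x +ℚ t *ℚ c +ℚ c ≡ x +ℚ (1ℚ +ℚ t) *ℚ c
  regroup = solve 3 (λ x t c → x :+ t :* c :+ c := x :+ (con 1ℚ :+ t) :* c) refl
    where open +-*-Solver

pigeonhole : ∀ (a : ℕ → ℚ) (c : ℚ) k → a 0 +ℚ toℚ (suc k) *ℚ c ≤ℚ sumBelow (2 + k) a →
  Σ ℕ λ i → 1 ≤ i × i ≤ suc k × c ≤ℚ a i
pigeonhole a c zero h =
  1 , ℕP.≤-refl , ℕP.≤-refl ,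
  +-cancelʳ-≤ (a 0) (subst₂ _≤ℚ_
    (trans (cong (a 0 +ℚ_) (ℚP.*-identityˡ c)) (ℚP.+-comm (a 0) c))
    (trans (cong (_+ℚ a 1) (ℚP.+-identityˡ (a 0))) (ℚP.+-comm (a 0) (a 1))) h)
pigeonhole a c (suc k) h = decide (c ℚP.≤? a (2 + k))
  where
  decide : Dec (c ≤ℚ a (2 + k)) → Σ ℕ λ i → 1 ≤ i × i ≤ 2 + k × c ≤ℚ a i
  decide (yes c≤a) = 2 + k , s≤s z≤n , ℕP.≤-refl , c≤a
  decide (no c≰a) =
    let i , 1≤i , i≤1+k , c≤aᵢ = pigeonhole a c k (pigeonhole-step a c k h (ℚP.<⇒≤ (ℚP.≰⇒> c≰a)))
    in  i , 1≤i , ℕP.m≤n⇒m≤1+n i≤1+k , c≤aᵢ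

-- Counting and measures

𝟙 : Bool → ℕ
𝟙 true  = 1
𝟙 false = 0

∣p∣≡∑𝟙 : ∀ {n} (p : Subset n) → ∣ p ∣ ≡ sum (λ j → 𝟙 (lookup p j))
∣p∣≡∑𝟙 []          = refl
∣p∣≡∑𝟙 (true ∷ p)  = cong suc (∣p∣≡∑𝟙 p)
∣p∣≡∑𝟙 (false ∷ p) = ∣p∣≡∑𝟙 p

∣p∩q∣≡∑𝟙 : ∀ {n} (p q : Subset n) → ∣ p ∩ q ∣ ≡ sum (λ j → 𝟙 (lookup p j ∧ lookup q j))
∣p∩q∣≡∑𝟙 p q = trans (∣p∣≡∑𝟙 (p ∩ q)) (sum-cong-≗ (λ j → cong 𝟙 (lookup-zipWith _∧_ j p q)))

∣p∣*m≤∑ : ∀ {n} (p : Subset n) (f : Fin n → ℕ) {m} → (∀ {j} → j ∈ p → m ≤ f j) →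
  ∣ p ∣ * m ≤ sum (λ j → 𝟙 (lookup p j) * f j)
∣p∣*m≤∑ []          f _  = z≤n
∣p∣*m≤∑ (true ∷ p)  f lb =
  ℕP.+-mono-≤ (ℕP.≤-trans (lb here) (ℕP.≤-reflexive (sym (ℕP.+-identityʳ (f zero)))))
              (∣p∣*m≤∑ p (f ∘ suc) (lb ∘ there))
∣p∣*m≤∑ (false ∷ p) f lb = ∣p∣*m≤∑ p (f ∘ suc) (lb ∘ there)

∃-minimum : ∀ {n} (f : Fin n → ℕ) (p : Subset n) → Nonempty p →
  Σ (Fin n) λ j → j ∈ p × (∀ {k} → k ∈ p → f j ≤ f k)
∃-minimum f (false ∷ p) (zero , ())
∃-minimum f (false ∷ p) (suc j , there j∈p) with ∃-minimum (f ∘ suc) p (j , j∈p)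
... | i , i∈p , min = suc i , there i∈p , λ { (there k∈p) → min k∈p }
∃-minimum f (true ∷ p) _ with nonempty? p
... | no ¬ne = zero , here , λ { here → ℕP.≤-refl ; (there k∈p) → ⊥-elim (¬ne (_ , k∈p)) }
... | yes ne with ∃-minimum (f ∘ suc) p ne
...   | i , i∈p , min with f zero ℕP.≤? f (suc i)
...     | yes f₀≤ = zero , here , λ { here → ℕP.≤-refl ; (there k∈p) → ℕP.≤-trans f₀≤ (min k∈p) }
...     | no f₀≰ = suc i , there i∈p , λ { here → ℕP.<⇒≤ (ℕP.≰⇒> f₀≰) ; (there k∈p) → min k∈p }

module _ {A : Set} where

  -- countAll and sumAll are these folds taken over allSubsets n.
  countIn : List A → (A → Bool) → ℕ
  countIn xs p = foldr (λ x acc → if p x then suc acc else acc) 0 xs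

  sumIn : List A → (A → ℚ) → ℚ
  sumIn xs f = foldr (λ x acc → f x +ℚ acc) 0ℚ xs

  countIn-mono : ∀ xs {p p′ : A → Bool} → (∀ x → p x ≡ true → p′ x ≡ true) →
    countIn xs p ≤ countIn xs p′
  countIn-mono []       p⊆p′ = z≤n
  countIn-mono (x ∷ xs) {p} {p′} p⊆p′ with p x in px | p′ x in p′x
  ... | true  | true  = s≤s (countIn-mono xs p⊆p′)
  ... | true  | false with () ← trans (sym (p⊆p′ x px)) p′x
  ... | false | true  = ℕP.m≤n⇒m≤1+n (countIn-mono xs p⊆p′)
  ... | false | false = countIn-mono xs p⊆p′

  countIn-∷ : ∀ x xs (p : A → Bool) → countIn (x ∷ xs) p ≡ 𝟙 (p x) + countIn xs p
  countIn-∷ x xs p with p x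
  ... | true  = refl
  ... | false = refl

  sumIn-cong : ∀ xs {f g : A → ℚ} → (∀ x → f x ≡ g x) → sumIn xs f ≡ sumIn xs g
  sumIn-cong []       _   = refl
  sumIn-cong (x ∷ xs) f≗g = cong₂ _+ℚ_ (f≗g x) (sumIn-cong xs f≗g)

  sumIn-+ : ∀ xs (f g : A → ℚ) → sumIn xs (λ x → f x +ℚ g x) ≡ sumIn xs f +ℚ sumIn xs g
  sumIn-+ []       f g = sym (ℚP.+-identityˡ 0ℚ)
  sumIn-+ (x ∷ xs) f g rewrite sumIn-+ xs f g =
    solve 4 (λ a b c d → (a :+ b) :+ (c :+ d) := (a :+ c) :+ (b :+ d)) refl
      (f x) (g x) (sumIn xs f) (sumIn xs g)
    where open +-*-Solver

  countIn-none : ∀ xs {p : A → Bool} → (∀ x → p x ≡ false) → countIn xs p ≡ 0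
  countIn-none []       _    = refl
  countIn-none (x ∷ xs) {p} none with p x | none x
  ... | false | _ = countIn-none xs none

  sumIn-if-countIn≡0 : ∀ xs {p : A → Bool} (f : A → ℚ) → countIn xs p ≡ 0 →
    sumIn xs (λ x → if p x then f x else 0ℚ) ≡ 0ℚ
  sumIn-if-countIn≡0 []       f _ = refl
  sumIn-if-countIn≡0 (x ∷ xs) {p} f count≡0 with p x
  ... | false = trans (ℚP.+-identityˡ _) (sumIn-if-countIn≡0 xs f count≡0)

degIn : ∀ {n} → List (Subset n) → Family n → Fin n → ℕ
degIn xs A j = countIn xs (λ Q → A Q ∧ lookup Q j)

∑𝟙*degIn-∷ : ∀ {n} Q xs (A : Family n) (C : Subset n) →
  sum (λ j → 𝟙 (lookup C j) * degIn (Q ∷ xs) A j) ≡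
  𝟙 (A Q) * ∣ Q ∩ C ∣ + sum (λ j → 𝟙 (lookup C j) * degIn xs A j)
∑𝟙*degIn-∷ Q xs A C = begin
  sum (λ j → 𝟙 (lookup C j) * degIn (Q ∷ xs) A j)
    ≡⟨ sum-cong-≗ (λ j → 𝟙*if≡ (A Q) (lookup Q j) (lookup C j) (d j)) ⟩
  sum (λ j → 𝟙 (A Q) * 𝟙 (lookup Q j ∧ lookup C j) + 𝟙 (lookup C j) * d j)
    ≡⟨ ∑-distrib-+ (λ j → 𝟙 (A Q) * 𝟙 (lookup Q j ∧ lookup C j)) (λ j → 𝟙 (lookup C j) * d j) ⟩
  sum (λ j → 𝟙 (A Q) * 𝟙 (lookup Q j ∧ lookup C j)) + sum (λ j → 𝟙 (lookup C j) * d j)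
    ≡⟨ cong (_+ sum (λ j → 𝟙 (lookup C j) * d j))
            (trans (sym (*-distribˡ-sum (𝟙 (A Q)) (λ j → 𝟙 (lookup Q j ∧ lookup C j))))
                   (cong (𝟙 (A Q) *_) (sym (∣p∩q∣≡∑𝟙 Q C)))) ⟩
  𝟙 (A Q) * ∣ Q ∩ C ∣ + sum (λ j → 𝟙 (lookup C j) * d j) ∎
  where
  open ≡-Reasoning
  d = degIn xs A
  𝟙*if≡ : ∀ a q c d → 𝟙 c * (if a ∧ q then suc d else d) ≡ 𝟙 a * 𝟙 (q ∧ c) + 𝟙 c * d
  𝟙*if≡ true  true  true  d = refl
  𝟙*if≡ true  true  false d = refl
  𝟙*if≡ true  false true  d = refl
  𝟙*if≡ true  false false d = refl
  𝟙*if≡ false q     true  d = refl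
  𝟙*if≡ false q     false d = refl

∑𝟙*degIn≤ : ∀ {n} xs (A : Family n) (C : Subset n) {b} → (∀ Q → A Q ≡ true → ∣ Q ∩ C ∣ ≤ b) →
  sum (λ j → 𝟙 (lookup C j) * degIn xs A j) ≤ countIn xs A * b
∑𝟙*degIn≤ {n} [] A C _ =
  ℕP.≤-reflexive (trans (sum-cong-≗ (λ j → ℕP.*-zeroʳ (𝟙 (lookup C j)))) (sum-replicate-zero n))
∑𝟙*degIn≤ (Q ∷ xs) A C {b} bound = begin
  sum (λ j → 𝟙 (lookup C j) * degIn (Q ∷ xs) A j)
    ≡⟨ ∑𝟙*degIn-∷ Q xs A C ⟩
  𝟙 (A Q) * ∣ Q ∩ C ∣ + sum (λ j → 𝟙 (lookup C j) * degIn xs A j)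
    ≤⟨ ℕP.+-mono-≤ (𝟙*-monoʳ-≤ (A Q) (bound Q)) (∑𝟙*degIn≤ xs A C bound) ⟩
  𝟙 (A Q) * b + countIn xs A * b
    ≡⟨ sym (ℕP.*-distribʳ-+ b (𝟙 (A Q)) (countIn xs A)) ⟩
  (𝟙 (A Q) + countIn xs A) * b
    ≡⟨ cong (_* b) (sym (countIn-∷ Q xs A)) ⟩
  countIn (Q ∷ xs) A * b ∎
  where
  open ℕP.≤-Reasoning
  𝟙*-monoʳ-≤ : ∀ a {x y} → (a ≡ true → x ≤ y) → 𝟙 a * x ≤ 𝟙 a * y
  𝟙*-monoʳ-≤ true  x≤y = ℕP.*-monoʳ-≤ 1 (x≤y refl)
  𝟙*-monoʳ-≤ false _   = z≤n

_⊆ᶠ_ : ∀ {n} → Family n → Family n → Set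
A ⊆ᶠ B = ∀ Q → A Q ≡ true → B Q ≡ true

measure-split : ∀ {n} (μ : Weights n) {A B : Family n} → B ⊆ᶠ A →
  measure μ A ≡ measure μ B +ℚ measure μ (λ Q → A Q ∧ not (B Q))
measure-split {n} μ {A} {B} B⊆A =
  trans (sumIn-cong (allSubsets n) split)
        (sumIn-+ (allSubsets n) (restrict B) (restrict (λ Q → A Q ∧ not (B Q))))
  where
  restrict : Family n → Subset n → ℚ
  restrict 𝒜 Q = if 𝒜 Q then μ Q else 0ℚ
  split : ∀ Q → restrict A Q ≡ restrict B Q +ℚ restrict (λ Q → A Q ∧ not (B Q)) Q
  split Q with A Q | B Q | B⊆A Q
  ... | true  | true  | _   = sym (ℚP.+-identityʳ (μ Q))
  ... | true  | false | _   = sym (ℚP.+-identityˡ (μ Q))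
  ... | false | false | _   = sym (ℚP.+-identityˡ 0ℚ)
  ... | false | true  | B⇒A with () ← B⇒A refl

measure-empty : ∀ {n} (μ : Weights n) {A : Family n} → (∀ Q → A Q ≡ false) → measure μ A ≡ 0ℚ
measure-empty {n} μ none = sumIn-if-countIn≡0 (allSubsets n) μ (countIn-none (allSubsets n) none)

module _ {n q : ℕ} {μ : Weights n} (dist : IsDistribution n q μ) where

  measure-supp : measure μ (supp μ) ≡ 1ℚ
  measure-supp = trans (sumIn-cong (allSubsets n) off-supp-zero) (proj₂ (proj₂ dist))
    where
    off-supp-zero : ∀ Q → (if supp μ Q then μ Q else 0ℚ) ≡ μ Q
    off-supp-zero Q with supp μ Q in suppQ
    ... | true  = refl
    ... | false = ℚP.≤-antisym (proj₁ dist Q)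
                    (ℚP.≮⇒≥ λ 0<μQ → not-¬ (dec-true (0ℚ ℚP.<? μ Q) 0<μQ) suppQ)

  suppSize≥1 : 1 ≤ suppSize μ
  suppSize≥1 with suppSize μ in size
  ... | suc _ = s≤s z≤n
  ... | zero with () ← trans (sym (sumIn-if-countIn≡0 (allSubsets n) μ size)) measure-supp

-- Cores

deg-mono : ∀ {n} {A B : Family n} → A ⊆ᶠ B → ∀ j → deg A j ≤ deg B j
deg-mono {n} A⊆B j = countIn-mono (allSubsets n) λ Q AQ∧j∈Q →
  trans (cong (_∧ lookup Q j) (A⊆B Q (∧-conicalˡ _ _ AQ∧j∈Q))) (∧-conicalʳ _ _ AQ∧j∈Q)

module _ {n q e : ℕ} {A : Family n} {j : Fin n} where

  ∈-coreOf⁻ : j ∈ coreOf n q e A → n ^ e ≤ deg A j ^ q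
  ∈-coreOf⁻ j∈ =
    ℕP.≤ᵇ⇒≤ _ _ (Equivalence.from T-≡ (trans (sym (lookup∘tabulate _ j)) ([]=⇒lookup j∈)))

  ∈-coreOf⁺ : n ^ e ≤ deg A j ^ q → j ∈ coreOf n q e A
  ∈-coreOf⁺ le = lookup⇒[]= j _ (trans (lookup∘tabulate _ j) (dec-true (_ ℕP.≤? _) le))

  ∉-coreOf⁻ : j ∉ coreOf n q e A → deg A j ^ q < n ^ e
  ∉-coreOf⁻ j∉ = ℕP.≰⇒> (j∉ ∘ ∈-coreOf⁺)

coreOf-anti : ∀ {n q e e′} {A B : Family n} → n ^ e ≤ n ^ e′ → B ⊆ᶠ A →
  coreOf n q e′ B ⊆ coreOf n q e A
coreOf-anti {q = q} {e} {e′} {A} {B} nᵉ≤nᵉ′ B⊆A {j} j∈ = ∈-coreOf⁺ {q = q} {e} {A}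
  (ℕP.≤-trans nᵉ≤nᵉ′ (ℕP.≤-trans (∈-coreOf⁻ {q = q} {e′} {B} j∈) (ℕP.^-monoˡ-≤ q (deg-mono B⊆A j))))

^coreExp-mono : ∀ n i → n ^ coreExp i ≤ n ^ coreExp (suc i)
^coreExp-mono n       zero    = ℕP.≤-refl
^coreExp-mono zero    (suc i) = z≤n
^coreExp-mono (suc n) (suc i) = ℕP.^-monoʳ-≤ (suc n) (ℕP.n≤1+n (suc i))

∩-monoʳ-⊆ : ∀ {n} (p : Subset n) {q r} → q ⊆ r → p ∩ q ⊆ p ∩ r
∩-monoʳ-⊆ p {q} q⊆r x∈p∩q = let x∈p , x∈q = x∈p∩q⁻ p q x∈p∩q in x∈p∩q⁺ (x∈p , q⊆r x∈q)

^-distrib-* : ∀ a b k → (a * b) ^ k ≡ a ^ k * b ^ k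
^-distrib-* a b zero    = refl
^-distrib-* a b (suc k) rewrite ^-distrib-* a b k =
  solve 4 (λ a b x y → (a :* b) :* (x :* y) := (a :* x) :* (b :* y)) refl a b (a ^ k) (b ^ k)
  where open ℕSolver

0^n≡0 : ∀ {m} → 1 ≤ m → 0 ^ m ≡ 0
0^n≡0 (s≤s z≤n) = refl

smallCore : ∀ {n q i} (C : Subset n) (s : ℕ) (η : ℚ) → 1 ≤ q → i ≤ q → 1 ≤ s →
  toℚ s ≤ℚ η *ℚ toℚ n → ∣ C ∣ ^ q * n ^ i ≤ (s * (q ∸ 1)) ^ q → SmallCore n q i (η *ℚ toℚ q) C
smallCore {n} {suc q′} {i} C s η (s≤s z≤n) i≤q 1≤s s≤ηn bound =
  0<ηq , ℚP.*-cancelʳ-<-nonNeg (toℚ (n ^ i)) {{nonNegative (toℚ-nonNeg (n ^ i))}} chain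
  where
  q = suc q′
  ηn = η *ℚ toℚ n
  0<ηn : 0ℚ <ℚ ηn
  0<ηn = ℚP.<-≤-trans (toℚ-mono-< 1≤s) s≤ηn
  0<η : 0ℚ <ℚ η
  0<η = ℚP.*-cancelʳ-<-nonNeg (toℚ n) {{nonNegative (toℚ-nonNeg n)}}
          (subst (_<ℚ ηn) (sym (ℚP.*-zeroˡ (toℚ n))) 0<ηn)
  0<ηq : 0ℚ <ℚ η *ℚ toℚ q
  0<ηq = *-pos 0<η (toℚ-mono-< (s≤s (z≤n {q′})))
  ηnq≡ηqn : ηn *ℚ toℚ q ≡ (η *ℚ toℚ q) *ℚ toℚ n
  ηnq≡ηqn = solve 3 (λ a b c → (a :* b) :* c := (a :* c) :* b) refl η (toℚ n) (toℚ q)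
    where open +-*-Solver
  chain : toℚ ∣ C ∣ ^ℚ q *ℚ toℚ (n ^ i) <ℚ (η *ℚ toℚ q) ^ℚ q *ℚ toℚ (n ^ (q ∸ i)) *ℚ toℚ (n ^ i)
  chain = begin-strict
    toℚ ∣ C ∣ ^ℚ q *ℚ toℚ (n ^ i)
      ≡⟨ sym (trans (toℚ-* (∣ C ∣ ^ q) (n ^ i)) (cong (_*ℚ toℚ (n ^ i)) (toℚ-^ ∣ C ∣ q))) ⟩
    toℚ (∣ C ∣ ^ q * n ^ i)
      ≤⟨ toℚ-mono-≤ bound ⟩
    toℚ ((s * q′) ^ q)
      ≡⟨ trans (toℚ-^ (s * q′) q) (cong (_^ℚ q) (toℚ-* s q′)) ⟩
    (toℚ s *ℚ toℚ q′) ^ℚ q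
      ≤⟨ ^ℚ-monoˡ-≤ q (*-nonNeg (toℚ-nonNeg s) (toℚ-nonNeg q′))
           (ℚP.*-monoʳ-≤-nonNeg (toℚ q′) {{nonNegative (toℚ-nonNeg q′)}} s≤ηn) ⟩
    (ηn *ℚ toℚ q′) ^ℚ q
      <⟨ ^ℚ-monoˡ-< q′ (*-nonNeg (ℚP.<⇒≤ 0<ηn) (toℚ-nonNeg q′))
           (ℚP.*-monoʳ-<-pos ηn {{positive 0<ηn}} (toℚ-mono-< (ℕP.n<1+n q′))) ⟩
    (ηn *ℚ toℚ q) ^ℚ q
      ≡⟨ trans (cong (_^ℚ q) ηnq≡ηqn) (^ℚ-distrib-* (η *ℚ toℚ q) (toℚ n) q) ⟩
    (η *ℚ toℚ q) ^ℚ q *ℚ toℚ n ^ℚ q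
      ≡⟨ cong ((η *ℚ toℚ q) ^ℚ q *ℚ_) (sym (toℚ-^ n q)) ⟩
    (η *ℚ toℚ q) ^ℚ q *ℚ toℚ (n ^ q)
      ≡⟨ cong (λ m → (η *ℚ toℚ q) ^ℚ q *ℚ toℚ m) nᵠ≡nᵠ⁻ⁱ*nⁱ ⟩
    (η *ℚ toℚ q) ^ℚ q *ℚ toℚ (n ^ (q ∸ i) * n ^ i)
      ≡⟨ cong ((η *ℚ toℚ q) ^ℚ q *ℚ_) (toℚ-* (n ^ (q ∸ i)) (n ^ i)) ⟩
    (η *ℚ toℚ q) ^ℚ q *ℚ (toℚ (n ^ (q ∸ i)) *ℚ toℚ (n ^ i))
      ≡⟨ sym (ℚP.*-assoc ((η *ℚ toℚ q) ^ℚ q) (toℚ (n ^ (q ∸ i))) (toℚ (n ^ i))) ⟩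
    (η *ℚ toℚ q) ^ℚ q *ℚ toℚ (n ^ (q ∸ i)) *ℚ toℚ (n ^ i) ∎
    where
    open ℚP.≤-Reasoning
    nᵠ≡nᵠ⁻ⁱ*nⁱ : n ^ q ≡ n ^ (q ∸ i) * n ^ i
    nᵠ≡nᵠ⁻ⁱ*nⁱ = trans (cong (n ^_) (sym (ℕP.m∸n+n≡m i≤q))) (ℕP.^-distribˡ-+-* n (q ∸ i) i)

-- The strata

module Strata {n q : ℕ} {μ : Weights n} (dist : IsDistribution n q μ) where

  M : ℕ → Family n
  M = 𝓜 n q μ

  C : ℕ → Subset n
  C = 𝒞 n q μ

  S : ℕ → Family n
  S = 𝒮 n q μ

  𝓜-suc⇒𝓜 : ∀ i → M (suc i) ⊆ᶠ M i
  𝓜-suc⇒𝓜 i _ = ∧-conicalˡ _ _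

  𝓜-suc⇒∉𝒮 : ∀ i Q → M (suc i) Q ≡ true → S i Q ≡ false
  𝓜-suc⇒∉𝒮 i Q M₁₊ᵢQ = not-injective (∧-conicalʳ _ _ M₁₊ᵢQ)

  𝒮⇒𝓜 : ∀ i → S i ⊆ᶠ M i
  𝒮⇒𝓜 i _ = ∧-conicalˡ _ _

  𝒮⇒∣Q∩𝒞∣≡q∸i : ∀ i Q → S i Q ≡ true → ∣ Q ∩ C i ∣ ≡ q ∸ i
  𝒮⇒∣Q∩𝒞∣≡q∸i i Q SᵢQ = ℕP.≡ᵇ⇒≡ _ _ (Equivalence.from T-≡ (∧-conicalʳ _ _ SᵢQ))

  𝒮-intro : ∀ i Q → M i Q ≡ true → ∣ Q ∩ C i ∣ ≡ q ∸ i → S i Q ≡ true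
  𝒮-intro i Q MᵢQ eq =
    trans (cong (_∧ (∣ Q ∩ C i ∣ ≡ᵇ q ∸ i)) MᵢQ) (Equivalence.to T-≡ (ℕP.≡⇒≡ᵇ _ _ eq))

  𝓜⊆supp : ∀ i → M i ⊆ᶠ supp μ
  𝓜⊆supp zero    _ = id
  𝓜⊆supp (suc i) Q = 𝓜⊆supp i Q ∘ 𝓜-suc⇒𝓜 i Q

  𝒞-suc⊆𝒞 : ∀ i → C (suc i) ⊆ C i
  𝒞-suc⊆𝒞 i = coreOf-anti {q = q} {coreExp i} {coreExp (suc i)} (^coreExp-mono n i) (𝓜-suc⇒𝓜 i)

  ∣Q∩𝒞∣≤q∸i : ∀ i Q → M i Q ≡ true → ∣ Q ∩ C i ∣ ≤ q ∸ i
  ∣Q∩𝒞∣<q∸i : ∀ i Q → M (suc i) Q ≡ true → ∣ Q ∩ C i ∣ < q ∸ i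

  ∣Q∩𝒞∣≤q∸i zero    Q M₀Q =
    ℕP.≤-trans (∣p∩q∣≤∣p∣ Q (C 0)) (ℕP.≤-reflexive (proj₁ (proj₂ dist) Q M₀Q))
  ∣Q∩𝒞∣≤q∸i (suc i) Q M₁₊ᵢQ = subst (∣ Q ∩ C (suc i) ∣ ≤_) (ℕP.pred[m∸n]≡m∸[1+n] q i)
    (ℕP.<⇒≤pred (ℕP.≤-<-trans (p⊆q⇒∣p∣≤∣q∣ (∩-monoʳ-⊆ Q (𝒞-suc⊆𝒞 i))) (∣Q∩𝒞∣<q∸i i Q M₁₊ᵢQ)))

  ∣Q∩𝒞∣<q∸i i Q M₁₊ᵢQ =
    ℕP.≤∧≢⇒< (∣Q∩𝒞∣≤q∸i i Q MᵢQ) λ eq → not-¬ (𝒮-intro i Q MᵢQ eq) (𝓜-suc⇒∉𝒮 i Q M₁₊ᵢQ)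
    where MᵢQ = 𝓜-suc⇒𝓜 i Q M₁₊ᵢQ

  𝓜-exhausted : ∀ Q → M (suc q) Q ≡ false
  𝓜-exhausted Q with M (suc q) Q in M₁₊ᵩQ
  ... | false = refl
  ... | true  = ⊥-elim (ℕP.n≮0 (subst (∣ Q ∩ C q ∣ <_) (ℕP.n∸n≡0 q) (∣Q∩𝒞∣<q∸i q Q M₁₊ᵩQ)))

  measure-supp≡∑𝒮+𝓜 : ∀ k → measure μ (supp μ) ≡ sumBelow k (measure μ ∘ S) +ℚ measure μ (M k)
  measure-supp≡∑𝒮+𝓜 zero    = sym (ℚP.+-identityˡ _)
  measure-supp≡∑𝒮+𝓜 (suc k) = begin
    measure μ (supp μ)
      ≡⟨ measure-supp≡∑𝒮+𝓜 k ⟩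
    Σₖ +ℚ measure μ (M k)
      ≡⟨ cong (Σₖ +ℚ_) (measure-split μ (𝒮⇒𝓜 k)) ⟩
    Σₖ +ℚ (measure μ (S k) +ℚ measure μ (M (suc k)))
      ≡⟨ sym (ℚP.+-assoc Σₖ (measure μ (S k)) (measure μ (M (suc k)))) ⟩
    sumBelow (suc k) (measure μ ∘ S) +ℚ measure μ (M (suc k)) ∎
    where
    open ≡-Reasoning
    Σₖ = sumBelow k (measure μ ∘ S)

  ∑𝒮≡1 : sumBelow (suc q) (measure μ ∘ S) ≡ 1ℚ
  ∑𝒮≡1 = begin
    Σ𝒮                          ≡⟨ sym (ℚP.+-identityʳ Σ𝒮) ⟩
    Σ𝒮 +ℚ 0ℚ                    ≡⟨ cong (Σ𝒮 +ℚ_) (sym (measure-empty μ 𝓜-exhausted)) ⟩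
    Σ𝒮 +ℚ measure μ (M (suc q)) ≡⟨ sym (measure-supp≡∑𝒮+𝓜 (suc q)) ⟩
    measure μ (supp μ)          ≡⟨ measure-supp dist ⟩
    1ℚ                          ∎
    where
    open ≡-Reasoning
    Σ𝒮 = sumBelow (suc q) (measure μ ∘ S)

  core-size : ∀ k → suc k ≤ q → ∣ C (suc k) ∣ ^ q * n ^ suc k ≤ (suppSize μ * (q ∸ 1)) ^ q
  core-size k 1+k≤q = bySize (nonempty? (C i))
    where
    open ℕP.≤-Reasoning
    i = suc k
    d = deg (M i)
    ∣Q∩𝒞∣≤q∸1 : ∀ Q → M i Q ≡ true → ∣ Q ∩ C i ∣ ≤ q ∸ 1
    ∣Q∩𝒞∣≤q∸1 Q MᵢQ = ℕP.≤-trans (∣Q∩𝒞∣≤q∸i i Q MᵢQ) (ℕP.∸-monoʳ-≤ q (s≤s z≤n))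
    bySize : Dec (Nonempty (C i)) → ∣ C i ∣ ^ q * n ^ i ≤ (suppSize μ * (q ∸ 1)) ^ q
    bySize (no ∅) = begin
      ∣ C i ∣ ^ q * n ^ i ≡⟨ cong (λ c → c ^ q * n ^ i) ∣C∣≡0 ⟩
      0 ^ q * n ^ i       ≡⟨ cong (_* n ^ i) (0^n≡0 (ℕP.≤-trans (s≤s z≤n) 1+k≤q)) ⟩
      0                   ≤⟨ z≤n ⟩
      _                   ∎
      where ∣C∣≡0 = trans (cong ∣_∣ (Empty-unique ∅)) (∣⊥∣≡0 n)
    bySize (yes ne) =
      let j₀ , j₀∈C , minimal = ∃-minimum d (C i) ne in begin
      ∣ C i ∣ ^ q * n ^ i
        ≤⟨ ℕP.*-monoʳ-≤ (∣ C i ∣ ^ q) (∈-coreOf⁻ {q = q} {i} {M i} j₀∈C) ⟩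
      ∣ C i ∣ ^ q * d j₀ ^ q
        ≡⟨ sym (^-distrib-* ∣ C i ∣ (d j₀) q) ⟩
      (∣ C i ∣ * d j₀) ^ q
        ≤⟨ ℕP.^-monoˡ-≤ q (ℕP.≤-trans (∣p∣*m≤∑ (C i) d minimal)
                                      (∑𝟙*degIn≤ (allSubsets n) (M i) (C i) ∣Q∩𝒞∣≤q∸1)) ⟩
      (countAll (M i) * (q ∸ 1)) ^ q
        ≤⟨ ℕP.^-monoˡ-≤ q (ℕP.*-monoˡ-≤ (q ∸ 1) (countIn-mono (allSubsets n) (𝓜⊆supp i))) ⟩
      (suppSize μ * (q ∸ 1)) ^ q ∎

  deg-𝒮-outside-𝒞 : ∀ k {Q j} → S (2 + k) Q ≡ true → j ∈ Q → j ∉ C (2 + k) →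
    deg (S (2 + k)) j ^ q ≤ n ^ suc k
  deg-𝒮-outside-𝒞 k {Q} {j} S₂₊ₖQ j∈Q j∉C₂₊ₖ =
    ℕP.≤-trans (ℕP.^-monoˡ-≤ q (deg-mono S₂₊ₖ⊆M₁₊ₖ j))
               (ℕP.<⇒≤ (∉-coreOf⁻ {q = q} {suc k} {M (suc k)} j∉C₁₊ₖ))
    where
    S₂₊ₖ⊆M₁₊ₖ : S (2 + k) ⊆ᶠ M (suc k)
    S₂₊ₖ⊆M₁₊ₖ Q = 𝓜-suc⇒𝓜 (suc k) Q ∘ 𝒮⇒𝓜 (2 + k) Q
    -- Otherwise j would give Q a (q ∸ (1 + k))-th point in 𝒞₁₊ₖ, although Q ∉ 𝒮₁₊ₖ.
    j∉C₁₊ₖ : j ∉ C (suc k)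
    j∉C₁₊ₖ j∈C₁₊ₖ = ℕP.<-irrefl a≡pred[x] (ℕP.suc[m]≤n⇒m≤pred[n] (ℕP.≤-trans (s≤s a<b) b<x))
      where
      a<b : ∣ Q ∩ C (2 + k) ∣ < ∣ Q ∩ C (suc k) ∣
      a<b = p⊂q⇒∣p∣<∣q∣ ( ∩-monoʳ-⊆ Q (𝒞-suc⊆𝒞 (suc k))
                        , j , x∈p∩q⁺ (j∈Q , j∈C₁₊ₖ) , j∉C₂₊ₖ ∘ proj₂ ∘ x∈p∩q⁻ Q (C (2 + k)))
      b<x : ∣ Q ∩ C (suc k) ∣ < q ∸ suc k
      b<x = ∣Q∩𝒞∣<q∸i (suc k) Q (𝒮⇒𝓜 (2 + k) Q S₂₊ₖQ)
      a≡pred[x] : ∣ Q ∩ C (2 + k) ∣ ≡ pred (q ∸ suc k)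
      a≡pred[x] = trans (𝒮⇒∣Q∩𝒞∣≡q∸i (2 + k) Q S₂₊ₖQ) (sym (ℕP.pred[m∸n]≡m∸[1+n] q (suc k)))

  isConstellation : ∀ {i} (η : ℚ) → 1 ≤ i → i ≤ q → toℚ (suppSize μ) ≤ℚ η *ℚ toℚ n →
    (+ 1 / suc q) ≤ℚ measure μ (S i) → IsConstellation n q μ (η *ℚ toℚ q) i (C i) (S i)
  isConstellation {suc k} η _ i≤q s≤ηn heavy =
    (λ Q → 𝓜⊆supp (suc k) Q ∘ 𝒮⇒𝓜 (suc k) Q) ,
    smallCore (C (suc k)) (suppSize μ) η (ℕP.≤-trans (s≤s z≤n) i≤q) i≤q
              (suppSize≥1 dist) s≤ηn (core-size k i≤q) ,
    heavy ,
    𝒮⇒∣Q∩𝒞∣≡q∸i (suc k) ,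
    outside-core-sparse k
    where
    outside-core-sparse : ∀ k → 1 < suc k → ∀ j → Σ (Subset n) (λ Q → S (suc k) Q ≡ true × j ∈ Q) →
      lookup (C (suc k)) j ≡ false → deg (S (suc k)) j ^ q ≤ n ^ (suc k ∸ 1)
    outside-core-sparse zero    (s≤s ())
    outside-core-sparse (suc k) _ j (Q , S₂₊ₖQ , j∈Q) C₂₊ₖj≡false =
      deg-𝒮-outside-𝒞 k S₂₊ₖQ j∈Q (λ j∈C → not-¬ ([]=⇒lookup j∈C) C₂₊ₖj≡false)

lemma3p13 : (n q : ℕ) → 1 ≤ q → (η : ℚ) → (μ : Weights n) →
    IsDistribution n q μ →
    toℚ (suppSize μ) ≤ℚ (η *ℚ toℚ n) →
    measure μ (𝒮 n q μ 0) ≤ℚ (+ 1 / suc q) →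
    Σ ℕ λ i → (1 ≤ i) × (i ≤ q) ×
      IsConstellation n q μ (η *ℚ toℚ q) i (𝒞 n q μ i) (𝒮 n q μ i)
lemma3p13 n (suc k) (s≤s z≤n) η μ dist s≤ηn μ𝒮₀≤c =
  let i , 1≤i , i≤q , heavy = pigeonhole (measure μ ∘ S) c k total
  in  i , 1≤i , i≤q , isConstellation η 1≤i i≤q s≤ηn heavy
  where
  open Strata dist
  q = suc k
  c = + 1 / suc q
  total : measure μ (S 0) +ℚ toℚ q *ℚ c ≤ℚ sumBelow (suc q) (measure μ ∘ S)
  total = begin
    measure μ (S 0) +ℚ toℚ q *ℚ c  ≤⟨ ℚP.+-monoˡ-≤ (toℚ q *ℚ c) μ𝒮₀≤c ⟩
    c +ℚ toℚ q *ℚ c                ≡⟨ solve 2 (λ c t → c :+ t :* c := (con 1ℚ :+ t) :* c)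
                                               refl c (toℚ q) ⟩
    (1ℚ +ℚ toℚ q) *ℚ c             ≡⟨ cong (_*ℚ c) (sym (toℚ-+ 1 q)) ⟩
    toℚ (suc q) *ℚ c               ≡⟨ toℚ[1+m]*1/[1+m]≡1 q ⟩
    1ℚ                             ≡⟨ sym ∑𝒮≡1 ⟩
    sumBelow (suc q) (measure μ ∘ S) ∎
    where
    open ℚP.≤-Reasoning
    open +-*-Solver
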